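{- An $n\times n$ matrix $A$ with entries in $\mathbb{S}=\{0,1,1^\nu\}$ is nonsingular if and only if, by independently permuting its rows and its columns, it can be brought to a lower triangular form in which all diagonal entries equal $1$, all entries strictly above the diagonal equal $0$, and entries strictly below the diagonal are arbitrary elements of $\{0,1,1^\nu\}$.
   Context: The superboolean semiring $\mathbb{S}=\{0,1,1^\nu\}$ has addition $0+x=x$, $1+1=1^\nu$, $1+1^\nu=1^\nu+1^\nu=1^\nu$, and multiplication $0\cdot x=0$, $1\cdot x=x$, $1^\nu\cdot1^\nu=1^\nu$. The permanent of $A=(a_{i,j})$ is $\mathrm{per}(A)=\sum_{\pi\in S_n}a_{\pi(1),1}\cdots a_{\pi(n),n}$ computed in $\mathbb{S}$; $A$ is nonsingular if $\mathrm{per}(A)=1$ and singular otherwise. -}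

module Defs where

open import Data.Nat using (ℕ; zero; suc)
open import Data.Fin using (Fin; zero; suc; punchIn; _<_)
open import Data.List using (List; []; _∷_; map; concatMap; foldr)
open import Data.List using (allFin)
open import Data.Fin.Permutation using (Permutation′; _⟨$⟩ʳ_)

data 𝕊 : Set where
  𝟘 𝟙 𝟙ν : 𝕊

infixl 6 _⊕_
infixl 7 _⊗_

_⊕_ : 𝕊 → 𝕊 → 𝕊
𝟘  ⊕ y  = y
𝟙  ⊕ 𝟘  = 𝟙
𝟙  ⊕ 𝟙  = 𝟙ν
𝟙  ⊕ 𝟙ν = 𝟙ν
𝟙ν ⊕ 𝟘  = 𝟙ν
𝟙ν ⊕ 𝟙  = 𝟙ν
𝟙ν ⊕ 𝟙ν = 𝟙ν

_⊗_ : 𝕊 → 𝕊 → 𝕊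
𝟘  ⊗ y  = 𝟘
𝟙  ⊗ y  = y
𝟙ν ⊗ 𝟘  = 𝟘
𝟙ν ⊗ 𝟙  = 𝟙ν
𝟙ν ⊗ 𝟙ν = 𝟙ν

-- n×n matrices over 𝕊: A i j is the entry in row i, column j
Matrix : ℕ → Set
Matrix n = Fin n → Fin n → 𝕊

-- Enumeration of the symmetric group S_n as functions Fin n → Fin n
-- (each permutation appears exactly once): π(0) = i, π(suc j) = punchIn i (σ j).
perms : (n : ℕ) → List (Fin n → Fin n)
perms zero    = (λ ()) ∷ []
perms (suc n) = concatMap (λ i → map (λ σ → ext i σ) (perms n)) (allFin (suc n))
  where
  ext : Fin (suc n) → (Fin n → Fin n) → Fin (suc n) → Fin (suc n)
  ext i σ zero    = i
  ext i σ (suc j) = punchIn i (σ j)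

∑ : List 𝕊 → 𝕊
∑ = foldr _⊕_ 𝟘

∏ : (n : ℕ) → (Fin n → 𝕊) → 𝕊
∏ zero    f = 𝟙
∏ (suc n) f = f zero ⊗ ∏ n (λ j → f (suc j))

per : {n : ℕ} → Matrix n → 𝕊
per {n} A = ∑ (map (λ π → ∏ n (λ j → A (π j) j)) (perms n))

Nonsingular : {n : ℕ} → Matrix n → Set
Nonsingular A = per A ≡ 𝟙
  where open import Relation.Binary.PropositionalEquality using (_≡_)

UnitLowerTriangular : {n : ℕ} → Matrix n → Set
UnitLowerTriangular {n} B =
  ((i : Fin n) → B i i ≡ 𝟙) × ((i j : Fin n) → i < j → B i j ≡ 𝟘)
  where
  open import Relation.Binary.PropositionalEquality using (_≡_)
  open import Data.Product using (_×_)

PermEquivToUnitLowerTriangular : {n : ℕ} → Matrix n → Set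
PermEquivToUnitLowerTriangular {n} A =
  Σ (Permutation′ n) λ σ → Σ (Permutation′ n) λ τ →
    UnitLowerTriangular (λ i j → A (σ ⟨$⟩ʳ i) (τ ⟨$⟩ʳ j))
  where open import Data.Product using (Σ)

-- Over 𝕊 a sum is 1 exactly when one summand is 1 and all others are 0, and a product is
-- nonzero (resp. 1) exactly when all its factors are.  Hence per A = 1 iff A has exactly one
-- transversal, i.e. permutation π with every A (π j) j ≠ 0, and all its entries are 1.
-- Permuting the rows by π moves it to the diagonal, leaving the identity as the only transversal.
-- Then some row has no nonzero entry off the diagonal: otherwise pick one in every row; if the
-- choice is onto, its inverse is a second transversal, and if not, a point outside its image can
-- be deleted.  Putting that row and column first and recursing on the minor makes the matrix unit
-- lower triangular.  Conversely, a transversal ρ of a unit lower triangular matrix has j ≤ ρ j for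
-- all j, which forces ρ = id, and transversals are carried along by row and column permutations.

module Submission where

open import Defs
open import Data.Nat using (ℕ; zero; suc; s≤s)
open import Data.Nat.Properties using (1+n≰n; ≮⇒≥)
open import Data.Fin using (Fin; zero; suc; punchIn; punchOut; _<_; _≤_; _>_)
open import Data.Fin.Properties using (_≟_; any?; all?; ¬∀⟶∃¬; injective⇒≤; ≤∧≢⇒<; 0≢1+n; suc-injective)
open import Data.Fin.Properties using (punchIn-injective; punchInᵢ≢i; punchIn-punchOut; punchOut-injective)
open import Data.Fin.Induction using (>-wellFounded)
open import Data.Fin.Permutation as Perm using (Permutation′; _⟨$⟩ʳ_; _⟨$⟩ˡ_; inverseˡ; inverseʳ; permutation; _∘ₚ_)
open import Data.Fin.Permutation using (insert; insert-punchIn)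
open import Data.List using (List; []; _∷_; map; concatMap; allFin)
open import Data.List.Relation.Unary.Any using (Any; here; there; satisfied)
import Data.List.Relation.Unary.Any.Properties as Anyₚ
open import Data.List.Relation.Unary.All using ([])
import Data.List.Relation.Unary.All.Properties as Allₚ
import Data.List.Relation.Unary.AllPairs as AllPairs
open AllPairs using ([]; _∷_)
import Data.List.Relation.Unary.AllPairs.Properties as AllPairsₚ
import Data.List.Membership.Setoid as Membership
open import Data.List.Membership.Setoid.Properties using (∈-resp-≈; All[≉]⇒∉; ∈-map⁺; ∈-map⁻)
open import Data.List.Membership.Setoid.Properties using (∈-concatMap⁺; ∈-concatMap⁻)
open import Data.List.Relation.Unary.Unique.Setoid using (Unique)
import Data.List.Relation.Unary.Unique.Setoid.Properties as Unique
open import Data.List.Relation.Unary.Unique.Propositional.Properties using (allFin⁺)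
open import Data.Product using (Σ; ∃; _×_; _,_; proj₁; proj₂)
open import Data.Sum using (_⊎_; inj₁; inj₂)
open import Data.Empty using (⊥-elim)
open import Function using (_∘_; _⇔_; mk⇔)
open import Function.Definitions using (Congruent; Injective)
import Induction.WellFounded as WF
open import Relation.Binary using (Setoid)
open import Relation.Binary.PropositionalEquality
open import Relation.Nullary using (¬_; Dec; yes; no; contradiction; ¬?; _×-dec_)
open import Relation.Nullary.Decidable using (decidable-stable)

-- Arithmetic of 𝕊

⊕≡𝟘⇒ : ∀ x {y} → x ⊕ y ≡ 𝟘 → x ≡ 𝟘 × y ≡ 𝟘
⊕≡𝟘⇒ 𝟘 refl = refl , refl
⊕≡𝟘⇒ 𝟙 {𝟘} ()
⊕≡𝟘⇒ 𝟙 {𝟙} ()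
⊕≡𝟘⇒ 𝟙 {𝟙ν} ()
⊕≡𝟘⇒ 𝟙ν {𝟘} ()
⊕≡𝟘⇒ 𝟙ν {𝟙} ()
⊕≡𝟘⇒ 𝟙ν {𝟙ν} ()

⊕≡𝟙⇒ : ∀ x {y} → x ⊕ y ≡ 𝟙 → (x ≡ 𝟙 × y ≡ 𝟘) ⊎ (x ≡ 𝟘 × y ≡ 𝟙)
⊕≡𝟙⇒ 𝟘 refl = inj₂ (refl , refl)
⊕≡𝟙⇒ 𝟙 {𝟘} refl = inj₁ (refl , refl)
⊕≡𝟙⇒ 𝟙 {𝟙} ()
⊕≡𝟙⇒ 𝟙 {𝟙ν} ()
⊕≡𝟙⇒ 𝟙ν {𝟘} ()
⊕≡𝟙⇒ 𝟙ν {𝟙} ()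
⊕≡𝟙⇒ 𝟙ν {𝟙ν} ()

⊗≡𝟙⇒ : ∀ x {y} → x ⊗ y ≡ 𝟙 → x ≡ 𝟙 × y ≡ 𝟙
⊗≡𝟙⇒ 𝟙 refl = refl , refl
⊗≡𝟙⇒ 𝟙ν {𝟘} ()
⊗≡𝟙⇒ 𝟙ν {𝟙} ()
⊗≡𝟙⇒ 𝟙ν {𝟙ν} ()

⊗≡𝟘⇒ : ∀ x {y} → x ⊗ y ≡ 𝟘 → x ≡ 𝟘 ⊎ y ≡ 𝟘
⊗≡𝟘⇒ 𝟘 refl = inj₁ refl
⊗≡𝟘⇒ 𝟙 refl = inj₂ refl
⊗≡𝟘⇒ 𝟙ν {𝟘} refl = inj₂ refl

⊗-zeroʳ : ∀ x → x ⊗ 𝟘 ≡ 𝟘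
⊗-zeroʳ 𝟘 = refl
⊗-zeroʳ 𝟙 = refl
⊗-zeroʳ 𝟙ν = refl

≡𝟙⇒≢𝟘 : ∀ {x} → x ≡ 𝟙 → x ≢ 𝟘
≡𝟙⇒≢𝟘 refl ()

≟𝟘 : (x : 𝕊) → Dec (x ≡ 𝟘)
≟𝟘 𝟘 = yes refl
≟𝟘 𝟙 = no λ ()
≟𝟘 𝟙ν = no λ ()

∏-cong : ∀ n {f g : Fin n → 𝕊} → f ≗ g → ∏ n f ≡ ∏ n g
∏-cong zero f≗g = refl
∏-cong (suc n) f≗g = cong₂ _⊗_ (f≗g zero) (∏-cong n (f≗g ∘ suc))

∏≡𝟙⇒ : ∀ n {f : Fin n → 𝕊} → ∏ n f ≡ 𝟙 → ∀ j → f j ≡ 𝟙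
∏≡𝟙⇒ (suc n) {f} e zero = proj₁ (⊗≡𝟙⇒ (f zero) e)
∏≡𝟙⇒ (suc n) {f} e (suc j) = ∏≡𝟙⇒ n (proj₂ (⊗≡𝟙⇒ (f zero) e)) j

∏≡𝟙⇐ : ∀ n {f : Fin n → 𝕊} → (∀ j → f j ≡ 𝟙) → ∏ n f ≡ 𝟙
∏≡𝟙⇐ zero f≡𝟙 = refl
∏≡𝟙⇐ (suc n) f≡𝟙 rewrite f≡𝟙 zero = ∏≡𝟙⇐ n (f≡𝟙 ∘ suc)

∏≡𝟘⇒ : ∀ n {f : Fin n → 𝕊} → ∏ n f ≡ 𝟘 → ∃ λ j → f j ≡ 𝟘
∏≡𝟘⇒ (suc n) {f} e with ⊗≡𝟘⇒ (f zero) e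
... | inj₁ f₀≡𝟘 = zero , f₀≡𝟘
... | inj₂ rest≡𝟘 = let j , fj≡𝟘 = ∏≡𝟘⇒ n rest≡𝟘 in suc j , fj≡𝟘

∏≡𝟘⇐ : ∀ n {f : Fin n → 𝕊} j → f j ≡ 𝟘 → ∏ n f ≡ 𝟘
∏≡𝟘⇐ (suc n) zero e rewrite e = refl
∏≡𝟘⇐ (suc n) {f} (suc j) e = trans (cong (f zero ⊗_) (∏≡𝟘⇐ n j e)) (⊗-zeroʳ (f zero))

∑-map≡𝟙⇒Any : ∀ {a} {X : Set a} {t : X → 𝕊} xs → ∑ (map t xs) ≡ 𝟙 → Any (λ x → t x ≡ 𝟙) xs
∑-map≡𝟙⇒Any {t = t} (x ∷ xs) ∑≡𝟙 with ⊕≡𝟙⇒ (t x) ∑≡𝟙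
... | inj₁ (tx≡𝟙 , _) = here tx≡𝟙
... | inj₂ (_ , rest≡𝟙) = there (∑-map≡𝟙⇒Any xs rest≡𝟙)

module _ {a ℓ} (S : Setoid a ℓ) where
  open Setoid S using (_≈_) renaming (Carrier to X; refl to ≈-refl; sym to ≈-sym; trans to ≈-trans)
  open Membership S using (_∈_)

  ∑-map≡𝟘⇒ : ∀ {t : X → 𝕊} → Congruent _≈_ _≡_ t → ∀ {xs x} → ∑ (map t xs) ≡ 𝟘 → x ∈ xs → t x ≡ 𝟘
  ∑-map≡𝟘⇒ {t} t-cong {y ∷ _} ∑≡𝟘 (here x≈y) = trans (t-cong x≈y) (proj₁ (⊕≡𝟘⇒ (t y) ∑≡𝟘))
  ∑-map≡𝟘⇒ {t} t-cong {y ∷ _} ∑≡𝟘 (there x∈xs) = ∑-map≡𝟘⇒ t-cong (proj₂ (⊕≡𝟘⇒ (t y) ∑≡𝟘)) x∈xs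

  ∑-map≡𝟘⇐ : ∀ {t : X → 𝕊} xs → (∀ {x} → x ∈ xs → t x ≡ 𝟘) → ∑ (map t xs) ≡ 𝟘
  ∑-map≡𝟘⇐ [] _ = refl
  ∑-map≡𝟘⇐ (x ∷ xs) t≡𝟘 rewrite t≡𝟘 (here ≈-refl) = ∑-map≡𝟘⇐ xs (t≡𝟘 ∘ there)

  ∑-map≡𝟙⇒unique : ∀ {t : X → 𝕊} → Congruent _≈_ _≡_ t → ∀ {xs x y} → ∑ (map t xs) ≡ 𝟙 →
                   x ∈ xs → y ∈ xs → t x ≢ 𝟘 → t y ≢ 𝟘 → x ≈ y
  ∑-map≡𝟙⇒unique {t} t-cong {z ∷ xs} ∑≡𝟙 x∈ y∈ tx≢𝟘 ty≢𝟘 with ⊕≡𝟙⇒ (t z) ∑≡𝟙 | x∈ | y∈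
  ... | inj₁ _ | here x≈z | here y≈z = ≈-trans x≈z (≈-sym y≈z)
  ... | inj₁ (_ , rest≡𝟘) | _ | there y∈xs = contradiction (∑-map≡𝟘⇒ t-cong rest≡𝟘 y∈xs) ty≢𝟘
  ... | inj₁ (_ , rest≡𝟘) | there x∈xs | _ = contradiction (∑-map≡𝟘⇒ t-cong rest≡𝟘 x∈xs) tx≢𝟘
  ... | inj₂ (tz≡𝟘 , _) | here x≈z | _ = contradiction (trans (t-cong x≈z) tz≡𝟘) tx≢𝟘
  ... | inj₂ (tz≡𝟘 , _) | _ | here y≈z = contradiction (trans (t-cong y≈z) tz≡𝟘) ty≢𝟘
  ... | inj₂ (_ , rest≡𝟙) | there x∈xs | there y∈xs = ∑-map≡𝟙⇒unique t-cong rest≡𝟙 x∈xs y∈xs tx≢𝟘 ty≢𝟘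

  ∑-map≡𝟙⇐ : ∀ {t : X → 𝕊} → Congruent _≈_ _≡_ t → ∀ {xs x} → Unique S xs → x ∈ xs → t x ≡ 𝟙 →
             (∀ {y} → y ∈ xs → t y ≢ 𝟘 → y ≈ x) → ∑ (map t xs) ≡ 𝟙
  ∑-map≡𝟙⇐ {t} t-cong {z ∷ xs} (z∉xs ∷ xs!) (here x≈z) tx≡𝟙 only-x =
    cong₂ _⊕_ (trans (t-cong (≈-sym x≈z)) tx≡𝟙) (∑-map≡𝟘⇐ xs rest≡𝟘)
    where
    rest≡𝟘 : ∀ {y} → y ∈ xs → t y ≡ 𝟘
    rest≡𝟘 {y} y∈xs = decidable-stable (≟𝟘 (t y)) λ ty≢𝟘 →
      All[≉]⇒∉ S z∉xs (∈-resp-≈ S (≈-trans (only-x (there y∈xs) ty≢𝟘) x≈z) y∈xs)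
  ∑-map≡𝟙⇐ {t} t-cong {z ∷ xs} (z∉xs ∷ xs!) (there x∈xs) tx≡𝟙 only-x =
    trans (cong (_⊕ ∑ (map t xs)) tz≡𝟘) (∑-map≡𝟙⇐ t-cong xs! x∈xs tx≡𝟙 (only-x ∘ there))
    where
    tz≡𝟘 : t z ≡ 𝟘
    tz≡𝟘 = decidable-stable (≟𝟘 (t z)) λ tz≢𝟘 →
      All[≉]⇒∉ S z∉xs (∈-resp-≈ S (≈-sym (only-x (here ≈-refl) tz≢𝟘)) x∈xs)

-- Injections of Fin n

injective-resp-≗ : ∀ {n} {f g : Fin n → Fin n} → f ≗ g → Injective _≡_ _≡_ f → Injective _≡_ _≡_ g
injective-resp-≗ f≗g f-inj {x} {y} gx≡gy = f-inj (trans (f≗g x) (trans gx≡gy (sym (f≗g y))))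

injective⇒surjective : ∀ {n} {f : Fin n → Fin n} → Injective _≡_ _≡_ f → ∀ y → ∃ λ x → f x ≡ y
injective⇒surjective {suc n} {f} f-inj y with any? (λ x → f x ≟ y)
... | yes hit = hit
... | no miss = contradiction (injective⇒≤ shrink-injective) 1+n≰n
  where
  y≢f : ∀ x → y ≢ f x
  y≢f x y≡fx = miss (x , sym y≡fx)
  shrink-injective : Injective _≡_ _≡_ (λ x → punchOut (y≢f x))
  shrink-injective e = f-inj (punchOut-injective (y≢f _) (y≢f _) e)

injective⇒permutation : ∀ {n} {f : Fin n → Fin n} → Injective _≡_ _≡_ f →
                        Σ (Permutation′ n) λ π → ∀ i → π ⟨$⟩ʳ i ≡ f i
injective⇒permutation {f = f} f-inj =
  permutation f (proj₁ ∘ surj) (proj₂ ∘ surj) (λ x → f-inj (proj₂ (surj (f x)))) , λ _ → refl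
  where surj = injective⇒surjective f-inj

⟨$⟩ʳ-injective : ∀ {n} (π : Permutation′ n) → Injective _≡_ _≡_ (π ⟨$⟩ʳ_)
⟨$⟩ʳ-injective π {x} {y} πx≡πy = begin
  x                  ≡⟨ inverseˡ π ⟨
  π ⟨$⟩ˡ (π ⟨$⟩ʳ x)  ≡⟨ cong (π ⟨$⟩ˡ_) πx≡πy ⟩
  π ⟨$⟩ˡ (π ⟨$⟩ʳ y)  ≡⟨ inverseˡ π ⟩
  y                  ∎
  where open ≡-Reasoning

injective∧inflationary⇒≗id : ∀ {n} {f : Fin n → Fin n} → Injective _≡_ _≡_ f → (∀ i → i ≤ f i) →
                             ∀ i → f i ≡ i
injective∧inflationary⇒≗id {f = f} f-inj inflationary =
  WF.All.wfRec >-wellFounded _ (λ i → f i ≡ i) step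
  where
  step : ∀ i → (∀ {j} → j > i → f j ≡ j) → f i ≡ i
  step i fixed-above with f i ≟ i
  ... | yes fi≡i = fi≡i
  ... | no fi≢i = f-inj (fixed-above (≤∧≢⇒< (inflationary i) (fi≢i ∘ sym)))

insert-self : ∀ {m} i j (π : Permutation′ m) → insert i j π ⟨$⟩ʳ i ≡ j
insert-self i j π with i ≟ i
... | yes _ = refl
... | no i≢i = contradiction refl i≢i

punchIn-view : ∀ {m} (r x : Fin (suc m)) → x ≡ r ⊎ ∃ λ k → x ≡ punchIn r k
punchIn-view r x with r ≟ x
... | yes r≡x = inj₁ (sym r≡x)
... | no r≢x = inj₂ (punchOut r≢x , sym (punchIn-punchOut r≢x))

-- The enumeration perms

≗-setoid : ℕ → Setoid _ _
≗-setoid n = Fin n →-setoid Fin n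

infix 4 _∈_
_∈_ : ∀ {n} → (Fin n → Fin n) → List (Fin n → Fin n) → Set
_∈_ {n} = Membership._∈_ (≗-setoid n)

Extension : ℕ → Set
Extension n = Fin (suc n) → (Fin n → Fin n) → Fin (suc n) → Fin (suc n)

-- The helper with which Defs.perms extends σ by i is local to perms and cannot be named here;
-- these two defining equations, which hold by refl, are all that is used of it.
perms-suc : ∀ n → ∃ λ (ext : Extension n) →
  (∀ i σ → ext i σ zero ≡ i) × (∀ i σ j → ext i σ (suc j) ≡ punchIn i (σ j)) ×
  perms (suc n) ≡ concatMap (λ i → map (ext i) (perms n)) (allFin (suc n))
perms-suc n = _ , (λ _ _ → refl) , (λ _ _ _ → refl) , refl

module Blocks {n} (ext : Extension n) (ext-zero : ∀ i σ → ext i σ zero ≡ i)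
                  (ext-suc : ∀ i σ j → ext i σ (suc j) ≡ punchIn i (σ j)) where

  blocks : List (Fin n → Fin n) → List (Fin (suc n) → Fin (suc n))
  blocks L = concatMap (λ i → map (ext i) L) (allFin (suc n))

  ext-cong : ∀ i {σ σ′} → σ ≗ σ′ → ext i σ ≗ ext i σ′
  ext-cong i {σ} {σ′} σ≗σ′ zero = trans (ext-zero i σ) (sym (ext-zero i σ′))
  ext-cong i {σ} {σ′} σ≗σ′ (suc j) = begin
    ext i σ (suc j)      ≡⟨ ext-suc i σ j ⟩
    punchIn i (σ j)      ≡⟨ cong (punchIn i) (σ≗σ′ j) ⟩
    punchIn i (σ′ j)     ≡⟨ ext-suc i σ′ j ⟨
    ext i σ′ (suc j)     ∎
    where open ≡-Reasoning

  ext-cancel : ∀ i {σ σ′} → ext i σ ≗ ext i σ′ → σ ≗ σ′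
  ext-cancel i {σ} {σ′} e j =
    punchIn-injective i (σ j) (σ′ j) (trans (sym (ext-suc i σ j)) (trans (e (suc j)) (ext-suc i σ′ j)))

  ext-injective : ∀ i {σ} → Injective _≡_ _≡_ σ → Injective _≡_ _≡_ (ext i σ)
  ext-injective i {σ} σ-inj {zero} {zero} _ = refl
  ext-injective i {σ} σ-inj {zero} {suc y} e =
    contradiction (trans (sym (ext-suc i σ y)) (trans (sym e) (ext-zero i σ))) (punchInᵢ≢i i (σ y))
  ext-injective i {σ} σ-inj {suc x} {zero} e =
    contradiction (trans (sym (ext-suc i σ x)) (trans e (ext-zero i σ))) (punchInᵢ≢i i (σ x))
  ext-injective i {σ} σ-inj {suc x} {suc y} e =
    cong suc (σ-inj (punchIn-injective i (σ x) (σ y)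
      (trans (sym (ext-suc i σ x)) (trans e (ext-suc i σ y)))))

  ∈-blocks⁺ : ∀ {L σ} i → σ ∈ L → ext i σ ∈ blocks L
  ∈-blocks⁺ i σ∈L = ∈-concatMap⁺ (setoid _) (≗-setoid (suc n)) {xs = allFin (suc n)}
    (Anyₚ.tabulate⁺ {f = λ j → j} i (∈-map⁺ (≗-setoid n) (≗-setoid (suc n)) (ext-cong i) σ∈L))

  ∈-blocks⁻ : ∀ {L ρ} → ρ ∈ blocks L → ∃ λ i → ∃ λ σ → σ ∈ L × ρ ≗ ext i σ
  ∈-blocks⁻ ρ∈ with satisfied (∈-concatMap⁻ (setoid _) (≗-setoid (suc n)) {xs = allFin (suc n)} ρ∈)
  ... | i , ρ∈blockᵢ = i , ∈-map⁻ (≗-setoid n) (≗-setoid (suc n)) ρ∈blockᵢ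

  blocks-unique : ∀ {L} → Unique (≗-setoid n) L → Unique (≗-setoid (suc n)) (blocks L)
  blocks-unique L! = Unique.concat⁺ (≗-setoid (suc n))
    (Allₚ.map⁺ (Allₚ.tabulate⁺ λ i → Unique.map⁺ (≗-setoid n) (≗-setoid (suc n)) (ext-cancel i) L!))
    (AllPairsₚ.map⁺ (AllPairs.map disjoint (allFin⁺ (suc n))))
    where
    head-of : ∀ {L i ρ} → ρ ∈ map (ext i) L → ρ zero ≡ i
    head-of {i = i} ρ∈ with ∈-map⁻ (≗-setoid n) (≗-setoid (suc n)) ρ∈
    ... | σ , _ , ρ≗ = trans (ρ≗ zero) (ext-zero i σ)
    disjoint : ∀ {i j} → i ≢ j → ∀ {ρ} → ¬ (ρ ∈ map (ext i) _ × ρ ∈ map (ext j) _)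
    disjoint i≢j (ρ∈ᵢ , ρ∈ⱼ) = i≢j (trans (sym (head-of ρ∈ᵢ)) (head-of ρ∈ⱼ))

∈-perms⇒injective : ∀ n {ρ} → ρ ∈ perms n → Injective _≡_ _≡_ ρ
∈-perms⇒injective zero _ {()}
∈-perms⇒injective (suc n) ρ∈ with perms-suc n
... | ext , ext-zero , ext-suc , eq rewrite eq =
  let i , σ , σ∈ , ρ≗ = ∈-blocks⁻ ρ∈ in
  injective-resp-≗ (sym ∘ ρ≗) (ext-injective i (∈-perms⇒injective n σ∈))
  where open Blocks ext ext-zero ext-suc

injective⇒∈-perms : ∀ n {ρ} → Injective _≡_ _≡_ ρ → ρ ∈ perms n
injective⇒∈-perms zero _ = here λ ()
injective⇒∈-perms (suc n) {ρ} ρ-inj with perms-suc n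
... | ext , ext-zero , ext-suc , eq rewrite eq =
  ∈-resp-≈ (≗-setoid (suc n)) ext≗ρ (∈-blocks⁺ (ρ zero) (injective⇒∈-perms n σ-inj))
  where
  open Blocks ext ext-zero ext-suc
  ρ₀≢ : ∀ j → ρ zero ≢ ρ (suc j)
  ρ₀≢ j = 0≢1+n ∘ ρ-inj
  σ : Fin n → Fin n
  σ j = punchOut (ρ₀≢ j)
  σ-inj : Injective _≡_ _≡_ σ
  σ-inj e = suc-injective (ρ-inj (punchOut-injective (ρ₀≢ _) (ρ₀≢ _) e))
  ext≗ρ : ext (ρ zero) σ ≗ ρ
  ext≗ρ zero = ext-zero (ρ zero) σ
  ext≗ρ (suc j) = trans (ext-suc (ρ zero) σ j) (punchIn-punchOut (ρ₀≢ j))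

perms-unique : ∀ n → Unique (≗-setoid n) (perms n)
perms-unique zero = [] ∷ []
perms-unique (suc n) with perms-suc n
... | ext , ext-zero , ext-suc , eq rewrite eq = blocks-unique (perms-unique n)
  where open Blocks ext ext-zero ext-suc

-- Nonsingularity and transversals

IsTransversal : ∀ {n} → Matrix n → Permutation′ n → Set
IsTransversal A ρ = ∀ j → A (ρ ⟨$⟩ʳ j) j ≢ 𝟘

UniqueUnitTransversal : ∀ {n} → Matrix n → Set
UniqueUnitTransversal {n} A = Σ (Permutation′ n) λ π →
  (∀ j → A (π ⟨$⟩ʳ j) j ≡ 𝟙) × (∀ ρ → IsTransversal A ρ → ∀ j → ρ ⟨$⟩ʳ j ≡ π ⟨$⟩ʳ j)

term : ∀ {n} → Matrix n → (Fin n → Fin n) → 𝕊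
term {n} A ρ = ∏ n λ j → A (ρ j) j

term-cong : ∀ {n} (A : Matrix n) → Congruent _≗_ _≡_ (term A)
term-cong {n} A ρ≗ρ′ = ∏-cong n λ j → cong (λ r → A r j) (ρ≗ρ′ j)

nonsingular⇒uniqueUnitTransversal : ∀ {n} (A : Matrix n) → Nonsingular A → UniqueUnitTransversal A
nonsingular⇒uniqueUnitTransversal {n} A per≡𝟙
  with ρ₀ , ρ₀∈ , term≡𝟙 ← Membership.find (≗-setoid n) (∑-map≡𝟙⇒Any (perms n) per≡𝟙)
  with π , π≗ρ₀ ← injective⇒permutation (∈-perms⇒injective n ρ₀∈)
  = π , diag , unique
  where
  diag : ∀ j → A (π ⟨$⟩ʳ j) j ≡ 𝟙
  diag = ∏≡𝟙⇒ n (trans (term-cong A π≗ρ₀) term≡𝟙)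
  unique : ∀ ρ → IsTransversal A ρ → ∀ j → ρ ⟨$⟩ʳ j ≡ π ⟨$⟩ʳ j
  unique ρ ρ-transversal j = trans (ρ≗ρ₀ j) (sym (π≗ρ₀ j))
    where
    ρ≗ρ₀ : (ρ ⟨$⟩ʳ_) ≗ ρ₀
    ρ≗ρ₀ = ∑-map≡𝟙⇒unique (≗-setoid n) (term-cong A) per≡𝟙
      (injective⇒∈-perms n (⟨$⟩ʳ-injective ρ)) ρ₀∈
      (λ term≡𝟘 → let j , e = ∏≡𝟘⇒ n term≡𝟘 in ρ-transversal j e) (≡𝟙⇒≢𝟘 term≡𝟙)

uniqueUnitTransversal⇒nonsingular : ∀ {n} (A : Matrix n) → UniqueUnitTransversal A → Nonsingular A
uniqueUnitTransversal⇒nonsingular {n} A (π , diag , unique) =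
  ∑-map≡𝟙⇐ (≗-setoid n) (term-cong A) (perms-unique n) (injective⇒∈-perms n (⟨$⟩ʳ-injective π))
    (∏≡𝟙⇐ n diag) only-π
  where
  only-π : ∀ {ρ} → ρ ∈ perms n → term A ρ ≢ 𝟘 → ρ ≗ (π ⟨$⟩ʳ_)
  only-π ρ∈ term≢𝟘 j =
    let ρ′ , ρ′≗ρ = injective⇒permutation (∈-perms⇒injective n ρ∈)
        ρ′-transversal : IsTransversal A ρ′
        ρ′-transversal k e = term≢𝟘 (∏≡𝟘⇐ n k (subst (λ r → A r k ≡ 𝟘) (ρ′≗ρ k) e))
    in trans (sym (ρ′≗ρ j)) (unique ρ′ ρ′-transversal j)

-- Triangularisation

OnlyIdentityTransversal : ∀ {n} → Matrix n → Set
OnlyIdentityTransversal D = ∀ ρ → IsTransversal D ρ → ∀ i → ρ ⟨$⟩ʳ i ≡ i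

minor : ∀ {m} → Fin (suc m) → Matrix (suc m) → Matrix m
minor r D k l = D (punchIn r k) (punchIn r l)

insert-transversal : ∀ {m} (D : Matrix (suc m)) {r ρ} → D r r ≢ 𝟘 → IsTransversal (minor r D) ρ →
                     IsTransversal D (insert r r ρ)
insert-transversal D {r} {ρ} Drr≢𝟘 ρ-transversal x with punchIn-view r x
... | inj₁ refl rewrite insert-self r r ρ = Drr≢𝟘
... | inj₂ (k , refl) rewrite insert-punchIn r r ρ k = ρ-transversal k

minor-onlyIdentityTransversal : ∀ {m} (D : Matrix (suc m)) {r} → D r r ≢ 𝟘 → OnlyIdentityTransversal D →
                                OnlyIdentityTransversal (minor r D)
minor-onlyIdentityTransversal D {r} Drr≢𝟘 only ρ ρ-transversal k = punchIn-injective r _ _ (begin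
  punchIn r (ρ ⟨$⟩ʳ k)           ≡⟨ insert-punchIn r r ρ k ⟨
  insert r r ρ ⟨$⟩ʳ punchIn r k  ≡⟨ only (insert r r ρ) extended-transversal (punchIn r k) ⟩
  punchIn r k                    ∎)
  where
  open ≡-Reasoning
  extended-transversal : IsTransversal D (insert r r ρ)
  extended-transversal = insert-transversal D Drr≢𝟘 ρ-transversal

offDiagonalSelector⇒empty : ∀ {m} (D : Matrix m) → (∀ c → D c c ≢ 𝟘) → OnlyIdentityTransversal D →
  (f : Fin m → Fin m) → (∀ r → f r ≢ r) → (∀ r → D r (f r) ≢ 𝟘) → ¬ Fin m
offDiagonalSelector⇒empty {zero} _ _ _ _ _ _ ()
offDiagonalSelector⇒empty {suc m} D diag only f f-moves D-f x with all? (λ c → any? (λ r → f r ≟ c))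
... | yes f-surjective = f-moves x (trans (cong f (sym (g-fixes x))) (f∘g x))
  where
  g : Fin (suc m) → Fin (suc m)
  g c = proj₁ (f-surjective c)
  f∘g : ∀ c → f (g c) ≡ c
  f∘g c = proj₂ (f-surjective c)
  g-injective : Injective _≡_ _≡_ g
  g-injective {a} {b} ga≡gb = trans (sym (f∘g a)) (trans (cong f ga≡gb) (f∘g b))
  π : Permutation′ (suc m)
  π = proj₁ (injective⇒permutation g-injective)
  π-transversal : IsTransversal D π
  π-transversal c = subst (λ c′ → D (g c) c′ ≢ 𝟘) (f∘g c) (D-f (g c))
  g-fixes : ∀ c → g c ≡ c
  g-fixes = only π π-transversal
... | no ¬f-surjective with ¬∀⟶∃¬ (suc m) _ (λ c → any? (λ r → f r ≟ c)) ¬f-surjective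
... | c , c∉image =
  offDiagonalSelector⇒empty (minor c D) (diag ∘ punchIn c) (minor-onlyIdentityTransversal D (diag c) only)
    f′ f′-moves D-f′ (punchOut (c≢f c))
  where
  c≢f : ∀ r → c ≢ f r
  c≢f r c≡fr = c∉image (r , sym c≡fr)
  f′ : Fin m → Fin m
  f′ k = punchOut (c≢f (punchIn c k))
  f′-moves : ∀ k → f′ k ≢ k
  f′-moves k f′k≡k =
    f-moves (punchIn c k) (trans (sym (punchIn-punchOut (c≢f (punchIn c k)))) (cong (punchIn c) f′k≡k))
  D-f′ : ∀ k → minor c D k (f′ k) ≢ 𝟘
  D-f′ k rewrite punchIn-punchOut (c≢f (punchIn c k)) = D-f (punchIn c k)

offDiagonalNonzero? : ∀ {m} (D : Matrix m) r → Dec (∃ λ c → c ≢ r × D r c ≢ 𝟘)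
offDiagonalNonzero? D r = any? λ c → ¬? (c ≟ r) ×-dec ¬? (≟𝟘 (D r c))

offDiagonalZeroRow : ∀ {m} (D : Matrix (suc m)) → (∀ c → D c c ≢ 𝟘) → OnlyIdentityTransversal D →
                     ∃ λ r → ∀ c → c ≢ r → D r c ≡ 𝟘
offDiagonalZeroRow {m} D diag only with any? (λ r → ¬? (offDiagonalNonzero? D r))
... | yes (r , none) = r , λ c c≢r → decidable-stable (≟𝟘 (D r c)) λ Drc≢𝟘 → none (c , c≢r , Drc≢𝟘)
... | no ¬zeroRow = ⊥-elim (offDiagonalSelector⇒empty D diag only f f-moves D-f zero)
  where
  offDiagonal : ∀ r → ∃ λ c → c ≢ r × D r c ≢ 𝟘
  offDiagonal r = decidable-stable (offDiagonalNonzero? D r) λ none → ¬zeroRow (r , none)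
  f : Fin (suc m) → Fin (suc m)
  f = proj₁ ∘ offDiagonal
  f-moves : ∀ r → f r ≢ r
  f-moves = proj₁ ∘ proj₂ ∘ offDiagonal
  D-f : ∀ r → D r (f r) ≢ 𝟘
  D-f = proj₂ ∘ proj₂ ∘ offDiagonal

triangularise : ∀ {m} (D : Matrix m) → (∀ c → D c c ≢ 𝟘) → OnlyIdentityTransversal D →
                Σ (Permutation′ m) λ τ → ∀ i j → i < j → D (τ ⟨$⟩ʳ i) (τ ⟨$⟩ʳ j) ≡ 𝟘
triangularise {zero} _ _ _ = Perm.id , λ ()
triangularise {suc m} D diag only
  with r , zeroRow ← offDiagonalZeroRow D diag only
  with τ′ , upper′ ← triangularise (minor r D) (diag ∘ punchIn r)
                                   (minor-onlyIdentityTransversal D (diag r) only)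
  = τ , upper
  where
  τ : Permutation′ (suc m)
  τ = insert zero r τ′
  upper : ∀ i j → i < j → D (τ ⟨$⟩ʳ i) (τ ⟨$⟩ʳ j) ≡ 𝟘
  upper zero (suc j) _ rewrite insert-self zero r τ′ | insert-punchIn zero r τ′ j =
    zeroRow _ (punchInᵢ≢i r (τ′ ⟨$⟩ʳ j))
  upper (suc i) (suc j) (s≤s i<j) rewrite insert-punchIn zero r τ′ i | insert-punchIn zero r τ′ j =
    upper′ i j i<j

unitLowerTriangular⇒uniqueUnitTransversal : ∀ {n} (B : Matrix n) → UnitLowerTriangular B →
                                            UniqueUnitTransversal B
unitLowerTriangular⇒uniqueUnitTransversal B (diag , upper) = Perm.id , diag , λ ρ ρ-transversal →
  injective∧inflationary⇒≗id (⟨$⟩ʳ-injective ρ) λ j → ≮⇒≥ λ ρj<j → ρ-transversal j (upper _ _ ρj<j)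

uniqueUnitTransversal-permute : ∀ {n} (A : Matrix n) (σ τ : Permutation′ n) →
  UniqueUnitTransversal (λ i j → A (σ ⟨$⟩ʳ i) (τ ⟨$⟩ʳ j)) → UniqueUnitTransversal A
uniqueUnitTransversal-permute A σ τ (π , diag , unique) = Perm.flip τ ∘ₚ π ∘ₚ σ , diag′ , unique′
  where
  diag′ : ∀ j → A (σ ⟨$⟩ʳ (π ⟨$⟩ʳ (τ ⟨$⟩ˡ j))) j ≡ 𝟙
  diag′ j = subst (λ c → A (σ ⟨$⟩ʳ (π ⟨$⟩ʳ (τ ⟨$⟩ˡ j))) c ≡ 𝟙) (inverseʳ τ) (diag (τ ⟨$⟩ˡ j))
  unique′ : ∀ ρ → IsTransversal A ρ → ∀ j → ρ ⟨$⟩ʳ j ≡ σ ⟨$⟩ʳ (π ⟨$⟩ʳ (τ ⟨$⟩ˡ j))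
  unique′ ρ ρ-transversal j = begin
    ρ ⟨$⟩ʳ j                                    ≡⟨ inverseʳ σ ⟨
    σ ⟨$⟩ʳ (σ ⟨$⟩ˡ (ρ ⟨$⟩ʳ j))                  ≡⟨ cong (λ c → σ ⟨$⟩ʳ (σ ⟨$⟩ˡ (ρ ⟨$⟩ʳ c))) (inverseʳ τ) ⟨
    σ ⟨$⟩ʳ (ρ′ ⟨$⟩ʳ (τ ⟨$⟩ˡ j))                  ≡⟨ cong (σ ⟨$⟩ʳ_) (unique ρ′ ρ′-transversal (τ ⟨$⟩ˡ j)) ⟩
    σ ⟨$⟩ʳ (π ⟨$⟩ʳ (τ ⟨$⟩ˡ j))                   ∎
    where
    open ≡-Reasoning
    ρ′ : Permutation′ _
    ρ′ = τ ∘ₚ ρ ∘ₚ Perm.flip σ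
    ρ′-transversal : IsTransversal (λ i j → A (σ ⟨$⟩ʳ i) (τ ⟨$⟩ʳ j)) ρ′
    ρ′-transversal k = subst (λ r → A r (τ ⟨$⟩ʳ k) ≢ 𝟘) (sym (inverseʳ σ)) (ρ-transversal (τ ⟨$⟩ʳ k))

uniqueUnitTransversal⇒permEquivToUnitLowerTriangular : ∀ {n} (A : Matrix n) →
  UniqueUnitTransversal A → PermEquivToUnitLowerTriangular A
uniqueUnitTransversal⇒permEquivToUnitLowerTriangular A (π , diag , unique) =
  let τ , upper = triangularise (λ i j → A (π ⟨$⟩ʳ i) j) (≡𝟙⇒≢𝟘 ∘ diag) only
  in τ ∘ₚ π , τ , diag ∘ (τ ⟨$⟩ʳ_) , upper
  where
  only : OnlyIdentityTransversal (λ i j → A (π ⟨$⟩ʳ i) j)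
  only ρ ρ-transversal i = ⟨$⟩ʳ-injective π (unique (ρ ∘ₚ π) ρ-transversal i)

lemma3p2 : (n : ℕ) (A : Matrix n) → Nonsingular A ⇔ PermEquivToUnitLowerTriangular A
lemma3p2 n A = mk⇔
  (uniqueUnitTransversal⇒permEquivToUnitLowerTriangular A ∘ nonsingular⇒uniqueUnitTransversal A)
  λ (σ , τ , lower) → uniqueUnitTransversal⇒nonsingular A
    (uniqueUnitTransversal-permute A σ τ (unitLowerTriangular⇒uniqueUnitTransversal _ lower))
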